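{- Let $G$ be any graph of order $n$ and let $r = \phi(G)$. Then there exists a graph $G^*$ of order $n$ with $\omega(G^*) = \phi(G) = r$ such that $G^*$ dominates $G$ and $G^*$ is complete $r$-partite.
   Context: All graphs are simple. For a graph $G$ on $n$ vertices, $\phi(G)$ is the smallest integer $r$ for which $V(G)$ has a partition $V(G) = V_1 \cup \cdots \cup V_r$ such that $d(v) \le n - n_i$ for all $v \in V_i$ and all $i = 1,\dots,r$, where $n_i = |V_i|$ and $d(v)$ is the degree of $v$. $\omega$ denotes the clique number. If $H$ and $H^*$ are graphs of order $n$ with degree sequences $d_H(1) \ge \cdots \ge d_H(n)$ and $d_{H^*}(1) \ge \cdots \ge d_{H^*}(n)$ such that $d_H(i) \le d_{H^*}(i)$ for all $i$, then $H^*$ is said to dominate $H$. -}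

module Defs where

open import Data.Nat using (ℕ; _≤_; _<_; _∸_)
open import Data.Bool using (Bool; true; false; if_then_else_)
open import Data.Fin using (Fin; _≟_)
open import Data.Fin.Subset using (Subset; _∈_; ∣_∣)
open import Data.Fin.Permutation using (Permutation′; _⟨$⟩ʳ_)
open import Data.List using (List; map; allFin)
open import Data.Nat.ListAction using (sum)
open import Data.Product using (Σ; ∃; _×_)
open import Relation.Nullary using (¬_; does)
open import Relation.Binary.PropositionalEquality using (_≡_; _≢_)

record Graph (n : ℕ) : Set where
  field
    adj   : Fin n → Fin n → Bool
    sym   : ∀ u v → adj u v ≡ adj v u
    irrefl : ∀ v → adj v v ≡ false
open Graph public

countB : {n : ℕ} → (Fin n → Bool) → ℕ
countB {n} p = sum (map (λ u → if p u then 1 else 0) (allFin n))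

deg : {n : ℕ} → Graph n → Fin n → ℕ
deg G v = countB (adj G v)

partSize : {n r : ℕ} → (Fin n → Fin r) → Fin r → ℕ
partSize f i = countB (λ u → does (f u ≟ i))

Surjective : {n r : ℕ} → (Fin n → Fin r) → Set
Surjective {n} {r} f = ∀ (i : Fin r) → ∃ λ (u : Fin n) → f u ≡ i

-- V(G) has a partition into r (nonempty) parts V_1..V_r with d(v) ≤ n - n_i for v ∈ V_i
PhiPartition : {n : ℕ} → Graph n → ℕ → Set
PhiPartition {n} G r =
  Σ (Fin n → Fin r) λ f → Surjective f × (∀ v → deg G v ≤ n ∸ partSize f (f v))

IsPhi : {n : ℕ} → Graph n → ℕ → Set
IsPhi G r = PhiPartition G r × (∀ s → s < r → ¬ PhiPartition G s)

IsClique : {n : ℕ} → Graph n → Subset n → Set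
IsClique G S = ∀ u v → u ∈ S → v ∈ S → u ≢ v → adj G u v ≡ true

IsCliqueNumber : {n : ℕ} → Graph n → ℕ → Set
IsCliqueNumber {n} G k =
  (∃ λ (S : Subset n) → IsClique G S × ∣ S ∣ ≡ k)
  × (∀ (S : Subset n) → IsClique G S → ∣ S ∣ ≤ k)

SortsDegrees : {n : ℕ} → Graph n → Permutation′ n → Set
SortsDegrees G σ = ∀ i j → i Data.Fin.≤ j → deg G (σ ⟨$⟩ʳ j) ≤ deg G (σ ⟨$⟩ʳ i)

-- H* dominates H: with degree sequences sorted nonincreasingly, d_H(i) ≤ d_H*(i) for all i
Dominates : {n : ℕ} → Graph n → Graph n → Set
Dominates {n} Hs H =
  Σ (Permutation′ n) λ σ → Σ (Permutation′ n) λ τ →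
    SortsDegrees H σ × SortsDegrees Hs τ × (∀ i → deg H (σ ⟨$⟩ʳ i) ≤ deg Hs (τ ⟨$⟩ʳ i))

CompleteMultipartite : {n : ℕ} → Graph n → ℕ → Set
CompleteMultipartite {n} G r =
  Σ (Fin n → Fin r) λ f → Surjective f ×
    (∀ u v → adj G u v ≡ true → f u ≢ f v) × (∀ u v → f u ≢ f v → adj G u v ≡ true)

module Submission where

-- Take a φ-partition f : Fin n → Fin r of G (every vertex v
-- has d(v) ≤ n − |part of v|) and let G* be the complete r-partite graph
-- whose parts are the parts of f.  In G* every vertex v has degree exactly
-- n − |part of v|, so d_G(v) ≤ d_G*(v) vertex by vertex; pointwise
-- domination of two degree functions implies domination of their sorted
-- degree sequences, hence G* dominates G.  A clique of G* meets every part
-- at most once, so ω(G*) ≤ r, and one representative of each (nonempty)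
-- part gives a clique of size r.

open import Defs hiding (sym)
open import Data.Nat as ℕ using (ℕ; zero; suc; _∸_; s≤s)
open import Data.Nat.Properties as ℕₚ using (≤-refl; ≤-trans; ≤-antisym; <-≤-trans; <-irrefl; ≰⇒>)
open import Data.Nat.ListAction using (sum)
open import Data.Bool using (Bool; true; false; not; if_then_else_)
open import Data.Fin as Fin using (Fin; zero; suc; toℕ; fromℕ<; inject≤; _≟_)
open import Data.Fin.Properties using (toℕ<n; toℕ-inject≤; toℕ-fromℕ<; toℕ-injective; inject≤-injective; injective⇒≤; suc-injective)
open import Data.Fin.Subset using (Subset; _∈_; ∣_∣; ∁; inside; outside)
open import Data.Fin.Subset.Properties using (∣∁p∣≡n∸∣p∣)
open import Data.Fin.Permutation using (Permutation′; _⟨$⟩ʳ_; _⟨$⟩ˡ_; inverseˡ; inverseʳ; id; flip; lift₀; transpose; _∘ₚ_)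
open import Data.Vec using (_∷_; tabulate)
open import Data.Vec.Base using (here; there)
open import Data.Vec.Properties using (tabulate-∘; lookup∘tabulate; []=⇒lookup; lookup⇒[]=)
import Data.List as List
open import Data.List.Properties using (map-tabulate)
open import Data.Product using (Σ; ∃; _×_; _,_; proj₁; proj₂)
open import Data.Empty using (⊥; ⊥-elim)
open import Relation.Nullary using (does; yes; no)
open import Relation.Binary.PropositionalEquality using (_≡_; _≢_; refl; sym; trans; cong; subst; module ≡-Reasoning)

-- Counting.  countB p is the cardinality of the subset tabulated from p,
-- which lets us use the library's complement formula for subsets.

indicator : Bool → ℕ
indicator b = if b then 1 else 0

countB≡∣tabulate∣ : {n : ℕ} (p : Fin n → Bool) → countB p ≡ ∣ tabulate p ∣
countB≡∣tabulate∣ {n} p =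
  trans (cong sum (map-tabulate (λ u → u) (λ u → indicator (p u)))) (sum-indicators n p)
  where
  sum-indicators : (n : ℕ) (p : Fin n → Bool) →
                   sum (List.tabulate (λ u → indicator (p u))) ≡ ∣ tabulate p ∣
  sum-indicators zero    p = refl
  sum-indicators (suc n) p with p zero
  ... | true  = cong suc (sum-indicators n (λ u → p (suc u)))
  ... | false = sum-indicators n (λ u → p (suc u))

countB-not : {n : ℕ} (p : Fin n → Bool) → countB (λ u → not (p u)) ≡ n ∸ countB p
countB-not {n} p = begin
  countB (λ u → not (p u))   ≡⟨ countB≡∣tabulate∣ (λ u → not (p u)) ⟩
  ∣ tabulate (λ u → not (p u)) ∣ ≡⟨ cong ∣_∣ (tabulate-∘ not p) ⟩
  ∣ ∁ (tabulate p) ∣          ≡⟨ ∣∁p∣≡n∸∣p∣ (tabulate p) ⟩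
  n ∸ ∣ tabulate p ∣          ≡⟨ cong (n ∸_) (sym (countB≡∣tabulate∣ p)) ⟩
  n ∸ countB p               ∎
  where open ≡-Reasoning

-- Subsets.  The elements of S, listed in increasing order, give an
-- injection Fin ∣ S ∣ → Fin n onto S; it converts injections into and out
-- of S into bounds on ∣ S ∣.

enum : {n : ℕ} (S : Subset n) → Fin ∣ S ∣ → Fin n
enum (inside  ∷ S) zero    = zero
enum (inside  ∷ S) (suc i) = suc (enum S i)
enum (outside ∷ S) i       = suc (enum S i)

enum-injective : {n : ℕ} (S : Subset n) {i j : Fin ∣ S ∣} → enum S i ≡ enum S j → i ≡ j
enum-injective (inside  ∷ S) {zero}  {zero}  e = refl
enum-injective (inside  ∷ S) {suc i} {suc j} e = cong suc (enum-injective S (suc-injective e))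
enum-injective (outside ∷ S)                 e = enum-injective S (suc-injective e)

enum-∈ : {n : ℕ} (S : Subset n) (i : Fin ∣ S ∣) → enum S i ∈ S
enum-∈ (inside  ∷ S) zero    = here
enum-∈ (inside  ∷ S) (suc i) = there (enum-∈ S i)
enum-∈ (outside ∷ S) i       = there (enum-∈ S i)

enum-onto : {n : ℕ} (S : Subset n) (u : Fin n) → u ∈ S → ∃ λ i → enum S i ≡ u
enum-onto (inside  ∷ S) zero    here      = zero , refl
enum-onto (inside  ∷ S) (suc u) (there p) with enum-onto S u p
... | i , e = suc i , cong suc e
enum-onto (outside ∷ S) (suc u) (there p) with enum-onto S u p
... | i , e = i , cong suc e

∣S∣≤-of-injective-on : {n r : ℕ} (S : Subset n) (g : Fin n → Fin r) →
  (∀ u v → u ∈ S → v ∈ S → g u ≡ g v → u ≡ v) → ∣ S ∣ ℕ.≤ r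
∣S∣≤-of-injective-on S g inj = injective⇒≤ {f = λ i → g (enum S i)}
  λ {i} {j} e → enum-injective S (inj _ _ (enum-∈ S i) (enum-∈ S j) e)

≤∣S∣-of-injection-into : {n r : ℕ} (S : Subset n) (h : Fin r → Fin n) →
  (∀ {x y} → h x ≡ h y → x ≡ y) → (∀ i → h i ∈ S) → r ℕ.≤ ∣ S ∣
≤∣S∣-of-injection-into S h inj hS = injective⇒≤ {f = λ i → proj₁ (position i)}
  λ {x} {y} e → inj (trans (sym (proj₂ (position x)))
                      (trans (cong (enum S) e) (proj₂ (position y))))
  where
  position : ∀ i → ∃ λ j → enum S j ≡ h i
  position i = enum-onto S (h i) (hS i)

∈-tabulate⁻ : {n : ℕ} (g : Fin n → Bool) (u : Fin n) → u ∈ tabulate g → g u ≡ true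
∈-tabulate⁻ g u p = trans (sym (lookup∘tabulate g u)) ([]=⇒lookup p)

∈-tabulate⁺ : {n : ℕ} (g : Fin n → Bool) (u : Fin n) → g u ≡ true → u ∈ tabulate g
∈-tabulate⁺ g u e = lookup⇒[]= u (tabulate g) (trans (lookup∘tabulate g u) e)

SortedBy : {n : ℕ} → (Fin n → ℕ) → Permutation′ n → Set
SortedBy d σ = ∀ i j → i Fin.≤ j → d (σ ⟨$⟩ʳ j) ℕ.≤ d (σ ⟨$⟩ʳ i)

argmax : {n : ℕ} (d : Fin (suc n) → ℕ) → Σ (Fin (suc n)) λ m → ∀ k → d k ℕ.≤ d m
argmax {zero}  d = zero , λ { zero → ≤-refl }
argmax {suc n} d with argmax (λ k → d (suc k))
... | m , max with d zero ℕ.≤? d (suc m)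
... | yes d₀≤ = suc m , λ { zero → d₀≤ ; (suc k) → max k }
... | no  d₀≰ = zero  , λ { zero → ≤-refl ; (suc k) → ≤-trans (max k) (ℕₚ.<⇒≤ (≰⇒> d₀≰)) }

sort : {n : ℕ} (d : Fin n → ℕ) → Σ (Permutation′ n) (SortedBy d)
sort {zero}  d = id , λ ()
sort {suc n} d with argmax d
... | m , max with sort (λ k → d (transpose zero m ⟨$⟩ʳ suc k))
... | σ , sorted = lift₀ σ ∘ₚ transpose zero m , sorted′
  where
  sorted′ : SortedBy d (lift₀ σ ∘ₚ transpose zero m)
  sorted′ zero    j       _       = max _
  sorted′ (suc i) (suc j) (s≤s i≤j) = sorted i j i≤j

permutation-injective : {n : ℕ} (π : Permutation′ n) {x y : Fin n} → π ⟨$⟩ʳ x ≡ π ⟨$⟩ʳ y → x ≡ y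
permutation-injective π e = trans (sym (inverseˡ π)) (trans (cong (π ⟨$⟩ˡ_) e) (inverseˡ π))

larger-is-earlier : {n : ℕ} (d : Fin n → ℕ) (σ : Permutation′ n) → SortedBy d σ →
  ∀ i k → d (σ ⟨$⟩ʳ i) ℕ.< d (σ ⟨$⟩ʳ k) → k Fin.< i
larger-is-earlier d σ sorted i k smaller with toℕ k ℕ.<? toℕ i
... | yes k<i = k<i
... | no  k≮i = ⊥-elim (ℕₚ.<⇒≱ smaller (sorted i k (ℕₚ.≮⇒≥ k≮i)))

no-injection-below : {n : ℕ} (i : Fin n) (h : Fin n → Fin n) →
  (∀ {x y} → h x ≡ h y → x ≡ y) → (∀ j → j Fin.≤ i → h j Fin.< i) → ⊥
no-injection-below {n} i h inj below =
  <-irrefl refl (injective⇒≤ {f = squeezed} squeezed-injective)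
  where
  i<n : suc (toℕ i) ℕ.≤ n
  i<n = toℕ<n i
  up-to-i : Fin (suc (toℕ i)) → Fin n
  up-to-i j = inject≤ j i<n
  up-to-i-≤ : ∀ j → up-to-i j Fin.≤ i
  up-to-i-≤ j = subst (ℕ._≤ toℕ i) (sym (toℕ-inject≤ j i<n)) (ℕₚ.≤-pred (toℕ<n j))
  squeezed : Fin (suc (toℕ i)) → Fin (toℕ i)
  squeezed j = fromℕ< (below (up-to-i j) (up-to-i-≤ j))
  squeezed-injective : ∀ {x y} → squeezed x ≡ squeezed y → x ≡ y
  squeezed-injective {x} {y} e = inject≤-injective i<n i<n x y (inj (toℕ-injective (begin
    toℕ (h (up-to-i x)) ≡⟨ sym (toℕ-fromℕ< _) ⟩
    toℕ (squeezed x)   ≡⟨ cong toℕ e ⟩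
    toℕ (squeezed y)   ≡⟨ toℕ-fromℕ< _ ⟩
    toℕ (h (up-to-i y)) ∎)))
    where open ≡-Reasoning

-- If not, the i+1 largest a-positions would all
-- have b-values above b's i-th largest, i.e. fit into only i b-positions.
sorted-dominance : {n : ℕ} (a b : Fin n → ℕ) → (∀ v → a v ℕ.≤ b v) →
  (σ τ : Permutation′ n) → SortedBy a σ → SortedBy b τ →
  ∀ i → a (σ ⟨$⟩ʳ i) ℕ.≤ b (τ ⟨$⟩ʳ i)
sorted-dominance a b a≤b σ τ sortedσ sortedτ i with a (σ ⟨$⟩ʳ i) ℕ.≤? b (τ ⟨$⟩ʳ i)
... | yes ok = ok
... | no  a≰b = ⊥-elim (no-injection-below i (λ j → τ ⟨$⟩ˡ (σ ⟨$⟩ʳ j)) rank-injective rank-below)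
  where
  rank-injective : ∀ {x y} → τ ⟨$⟩ˡ (σ ⟨$⟩ʳ x) ≡ τ ⟨$⟩ˡ (σ ⟨$⟩ʳ y) → x ≡ y
  rank-injective e = permutation-injective σ (permutation-injective (flip τ) e)
  rank-below : ∀ j → j Fin.≤ i → τ ⟨$⟩ˡ (σ ⟨$⟩ʳ j) Fin.< i
  rank-below j j≤i = larger-is-earlier b τ sortedτ i _
    (<-≤-trans (≰⇒> a≰b) (≤-trans (sortedσ j i j≤i)
      (subst (λ v → a (σ ⟨$⟩ʳ j) ℕ.≤ b v) (sym (inverseʳ τ)) (a≤b _))))

pointwise⇒Dominates : {n : ℕ} (H Hs : Graph n) → (∀ v → deg H v ℕ.≤ deg Hs v) → Dominates Hs H
pointwise⇒Dominates H Hs deg≤ with sort (deg H) | sort (deg Hs)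
... | σ , sortedσ | τ , sortedτ =
  σ , τ , sortedσ , sortedτ , sorted-dominance (deg H) (deg Hs) deg≤ σ τ sortedσ sortedτ

same-label : {n r : ℕ} (f : Fin n → Fin r) → Fin n → Fin n → Bool
same-label f u v = does (f u ≟ f v)

same-label-sym : {n r : ℕ} (f : Fin n → Fin r) (u v : Fin n) → same-label f u v ≡ same-label f v u
same-label-sym f u v with f u ≟ f v | f v ≟ f u
... | yes _  | yes _  = refl
... | no _   | no _   = refl
... | yes e  | no ne  = ⊥-elim (ne (sym e))
... | no ne  | yes e  = ⊥-elim (ne (sym e))

same-label-refl : {n r : ℕ} (f : Fin n → Fin r) (u : Fin n) → same-label f u u ≡ true
same-label-refl f u with f u ≟ f u
... | yes _ = refl
... | no ne = ⊥-elim (ne refl)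

multipartite : {n r : ℕ} → (Fin n → Fin r) → Graph n
multipartite f = record
  { adj    = λ u v → not (same-label f v u)
  ; sym    = λ u v → cong not (same-label-sym f v u)
  ; irrefl = λ v → cong not (same-label-refl f v)
  }

multipartite-adj⇒≢ : {n r : ℕ} (f : Fin n → Fin r) (u v : Fin n) →
  adj (multipartite f) u v ≡ true → f u ≢ f v
multipartite-adj⇒≢ f u v adjacent e with f v ≟ f u | adjacent
... | yes _ | ()
... | no ne | _  = ne (sym e)

multipartite-≢⇒adj : {n r : ℕ} (f : Fin n → Fin r) (u v : Fin n) →
  f u ≢ f v → adj (multipartite f) u v ≡ true
multipartite-≢⇒adj f u v ne with f v ≟ f u
... | yes e = ⊥-elim (ne (sym e))
... | no _  = refl

-- A vertex is adjacent exactly to the vertices outside its own part.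
multipartite-deg : {n r : ℕ} (f : Fin n → Fin r) (v : Fin n) →
  deg (multipartite f) v ≡ n ∸ partSize f (f v)
multipartite-deg f v = countB-not (λ u → same-label f u v)

multipartite-complete : {n r : ℕ} (f : Fin n → Fin r) → Surjective f →
  CompleteMultipartite (multipartite f) r
multipartite-complete f onto = f , onto , multipartite-adj⇒≢ f , multipartite-≢⇒adj f

-- A clique meets every part at most once, so it has at most r vertices.
multipartite-clique-≤ : {n r : ℕ} (f : Fin n → Fin r) (S : Subset n) →
  IsClique (multipartite f) S → ∣ S ∣ ℕ.≤ r
multipartite-clique-≤ f S clique = ∣S∣≤-of-injective-on S f injective-on-S
  where
  injective-on-S : ∀ u v → u ∈ S → v ∈ S → f u ≡ f v → u ≡ v
  injective-on-S u v u∈S v∈S e with u ≟ v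
  ... | yes u≡v = u≡v
  ... | no  u≢v = ⊥-elim (multipartite-adj⇒≢ f u v (clique u v u∈S v∈S u≢v) e)

-- If every part is nonempty, one representative per part is a clique of size r.
multipartite-clique-number : {n r : ℕ} (f : Fin n → Fin r) → Surjective f →
  IsCliqueNumber (multipartite f) r
multipartite-clique-number {n} {r} f onto =
  (reps , reps-clique , ≤-antisym (multipartite-clique-≤ f reps reps-clique) r≤∣reps∣)
  , multipartite-clique-≤ f
  where
  rep : Fin r → Fin n
  rep i = proj₁ (onto i)
  f∘rep : ∀ i → f (rep i) ≡ i
  f∘rep i = proj₂ (onto i)
  is-rep : Fin n → Bool
  is-rep u = does (u ≟ rep (f u))
  reps : Subset n
  reps = tabulate is-rep
  ∈reps⇒rep : ∀ u → u ∈ reps → u ≡ rep (f u)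
  ∈reps⇒rep u u∈reps with u ≟ rep (f u) | ∈-tabulate⁻ is-rep u u∈reps
  ... | yes e | _ = e
  reps-clique : IsClique (multipartite f) reps
  reps-clique u v u∈ v∈ u≢v = multipartite-≢⇒adj f u v λ e →
    u≢v (trans (∈reps⇒rep u u∈) (trans (cong rep e) (sym (∈reps⇒rep v v∈))))
  rep-injective : ∀ {i j} → rep i ≡ rep j → i ≡ j
  rep-injective {i} {j} e = trans (sym (f∘rep i)) (trans (cong f e) (f∘rep j))
  rep-is-rep : ∀ i → is-rep (rep i) ≡ true
  rep-is-rep i with rep i ≟ rep (f (rep i))
  ... | yes _  = refl
  ... | no  ne = ⊥-elim (ne (cong rep (sym (f∘rep i))))
  r≤∣reps∣ : r ℕ.≤ ∣ reps ∣
  r≤∣reps∣ = ≤∣S∣-of-injection-into reps rep rep-injective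
               (λ i → ∈-tabulate⁺ is-rep (rep i) (rep-is-rep i))

phi-partition⇒multipartite : (n : ℕ) (G : Graph n) (r : ℕ) → PhiPartition G r →
  Σ (Graph n) λ Gs → IsCliqueNumber Gs r × Dominates Gs G × CompleteMultipartite Gs r
phi-partition⇒multipartite n G r (f , onto , deg≤) =
  multipartite f
  , multipartite-clique-number f onto
  , pointwise⇒Dominates G (multipartite f) deg≤deg*
  , multipartite-complete f onto
  where
  deg≤deg* : ∀ v → deg G v ℕ.≤ deg (multipartite f) v
  deg≤deg* v = subst (deg G v ℕ.≤_) (sym (multipartite-deg f v)) (deg≤ v)

theorem9 : (n : ℕ) (G : Graph n) (r : ℕ) → IsPhi G r →
    Σ (Graph n) λ Gs → IsCliqueNumber Gs r × Dominates Gs G × CompleteMultipartite Gs r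
theorem9 n G r (partition , _) = phi-partition⇒multipartite n G r partition
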